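{- Let $M = (Q, q_0, \delta)$ be a unary Turing machine such that $\delta(q,x) = (q',s',d')$ implies $q \neq q'$, and let $P_M$ be the Fractran program associated with $M$ (described in the context). For all configurations $c_1, c_2$ of $M$: (i) if $c_1 \to_M c_2$, then $n_{c_1} \to_{P_M}^* n_{c_2}$; (ii) if $c_1$ is a $\to_M$-normal form (i.e. no $c$ with $c_1 \to_M c$ exists), then $n_{c_1} \to_{P_M}^* \text{undefined}$, i.e. there is $m$ with $n_{c_1} \to_{P_M}^* m$ and $f_{P_M}(m)$ undefined.
   Context: Fractran: a Fractran program is a finite list $P$ of positive rationals $\frac{p_1}{q_1},\ldots,\frac{p_k}{q_k}$; $f_P(n) = n\cdot\frac{p_i}{q_i}$ for the first $i$ (in list order) with $n\cdot\frac{p_i}{q_i}\in\mathbb{N}$, and $f_P(n)$ is undefined if there is no such $i$. Write $n \to_P m$ if $m = f_P(n)$, and $\to_P^*$ for its reflexive–transitive closure. Unary Turing machines: $M = (Q,q_0,\delta)$ with finite state set $Q$, initial state $q_0\in Q$, and partial transition function $\delta : Q\times\{0,1\} \rightharpoonup Q\times\{0,1\}\times\{L,R\}$ ($0$ is the blank). A configuration is a pair $(q,\tau)$ with $q\in Q$ and $\tau:\mathbb{Z}\to\{0,1\}$ with finite support. Define $(q,\tau)\to_M(q',\tau')$ if either $\delta(q,\tau(0)) = (q',f,L)$, $\tau'(1)=f$ and $\tau'(n+1)=\tau(n)$ for all $n\neq 0$; or $\delta(q,\tau(0))=(q',f,R)$, $\tau'(-1)=f$ and $\tau'(n-1)=\tau(n)$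 for all $n\neq0$. Translation: choose pairwise distinct primes $l, h, r, l', h', r', m_{L,x}, m_{R,x}, c_x$ (for $x\in\{0,1\}$) and $p_q$ (for $q\in Q$). The Fractran program $P_M$ consists of the following fractions in this order (instances of one schematic rule are consecutive; their mutual order is immaterial): (1) $\frac{1}{p\cdot p'}$ for all $p,p'$ both in $\{m_{L,0},m_{L,1},m_{R,0},m_{R,1},c_0,c_1\}$, or both in $\{p_q : q\in Q\}$, or both in $\{h,h'\}$; (2) for $x\in\{0,1\}$: $\frac{m_{L,1-x}\, l'}{m_{L,x}\, l^2}$, $\frac{m_{L,1-x}\, r'^2}{m_{L,x}\, r}$, $\frac{m_{L,1-x}\, r'}{m_{L,x}\, h'}$, $\frac{m_{L,1-x}\, h}{m_{L,x}\, l}$, $\frac{c_0}{m_{L,x}}$; (3) for $x\in\{0,1\}$: $\frac{m_{R,1-x}\, r'}{m_{R,x}\, r^2}$, $\frac{m_{R,1-x}\, l'^2}{m_{R,x}\, l}$, $\frac{m_{R,1-x}\, l'}{m_{R,x}\, h'}$, $\frac{m_{R,1-x}\, h}{m_{R,x}\, r}$, $\frac{c_0}{m_{R,x}}$; (4) for $x\in\{0,1\}$: $\frac{c_{1-x}\, l}{c_x\, l'}$, $\frac{c_{1-x}\, r}{c_x\, r'}$, $\frac{1}{c_x}$; (5) $\frac{p_{q'}\, h'^{s'}\, m_{d,0}}{p_q\, h}$ whenever $\delta(q,1) = (q',s',d)$; (6) $\frac{1}{p_q\, h}$ for every $q\in Q$; (7) $\frac{p_{q'}\, h'^{s'}\,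 m_{d,0}}{p_q}$ whenever $\delta(q,0) = (q',s',d)$. For a configuration $c=(q,\tau)$ set $n_c = l^{L}\cdot p_q\cdot h^{H}\cdot r^{R}$ where $L=\sum_{i\ge0}2^i\tau(-1-i)$, $H=\tau(0)$, $R=\sum_{i\ge0}2^i\tau(1+i)$. -}

module Defs where

open import Data.Nat using (ℕ; zero; suc; _+_; _*_; _^_; _<_)
open import Data.Nat.Divisibility using (_∣_)
open import Data.Integer as ℤ using (ℤ; +_; -[1+_]; ∣_∣)
open import Data.Fin using (Fin; toℕ) renaming (zero to f0; suc to fsuc)
open import Data.List using (List; []; _∷_; _++_; map; concat; concatMap; allFin)
open import Data.List.Relation.Unary.All using (All)
open import Data.List.Relation.Binary.Pointwise using (Pointwise)
open import Data.List.Relation.Binary.Permutation.Propositional using (_↭_)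
open import Data.Maybe using (Maybe; just; nothing)
open import Data.Product using (_×_; _,_; Σ; Σ-syntax)
open import Relation.Binary.PropositionalEquality using (_≡_; _≢_)
open import Relation.Nullary using (¬_)

-- A fraction p/q is represented by the pair (p , q) of positive naturals.
Fraction : Set
Fraction = ℕ × ℕ

-- FStep P n m  :  m = f_P(n), i.e. the first fraction p/q of P with
-- n·p/q ∈ ℕ (equivalently q ∣ n·p) gives m = n·p/q (i.e. m·q = n·p).
data FStep : List Fraction → ℕ → ℕ → Set where
  here  : ∀ {p q P n m} → m * q ≡ n * p → FStep ((p , q) ∷ P) n m
  there : ∀ {p q P n m} → ¬ (q ∣ n * p) → FStep P n m → FStep ((p , q) ∷ P) n m

Undefined : List Fraction → ℕ → Set
Undefined P n = All (λ pq → ¬ (Data.Product.proj₂ pq ∣ n * Data.Product.proj₁ pq)) P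

Bit : Set
Bit = Fin 2

data Dir : Set where
  dL dR : Dir

record UTM : Set where
  field
    k  : ℕ
    q₀ : Fin k
    δ  : Fin k → Bit → Maybe (Fin k × Bit × Dir)

record Config (k : ℕ) : Set where
  field
    state   : Fin k
    tape    : ℤ → Bit
    bound   : ℕ
    support : ∀ i → bound < ∣ i ∣ → tape i ≡ f0

open Config public

data TMStep (M : UTM) : Config (UTM.k M) → Config (UTM.k M) → Set where
  stepL : ∀ {c c' f} →
          UTM.δ M (state c) (tape c (+ 0)) ≡ just (state c' , f , dL) →
          tape c' (+ 1) ≡ f →
          (∀ n → n ≢ + 0 → tape c' (n ℤ.+ + 1) ≡ tape c n) →
          TMStep M c c'
  stepR : ∀ {c c' f} →
          UTM.δ M (state c) (tape c (+ 0)) ≡ just (state c' , f , dR) →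
          tape c' (-[1+ 0 ]) ≡ f →
          (∀ n → n ≢ + 0 → tape c' (n ℤ.- + 1) ≡ tape c n) →
          TMStep M c c'

NoSelfLoop : UTM → Set
NoSelfLoop M = ∀ q x q' s' d → UTM.δ M q x ≡ just (q' , s' , d) → q ≢ q'

-- names of the primes
data Sym (k : ℕ) : Set where
  l h r l' h' r' : Sym k
  mL mR c : Bit → Sym k
  p : Fin k → Sym k

sumTo : ℕ → (ℕ → ℕ) → ℕ
sumTo zero    f = 0
sumTo (suc n) f = sumTo n f + f n

-- L, H, R of a configuration (the terms beyond 'bound' vanish)
Lval : ∀ {k} → Config k → ℕ
Lval cf = sumTo (bound cf) (λ i → 2 ^ i * toℕ (tape cf -[1+ i ]))

Hval : ∀ {k} → Config k → ℕ
Hval cf = toℕ (tape cf (+ 0))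

Rval : ∀ {k} → Config k → ℕ
Rval cf = sumTo (bound cf) (λ i → 2 ^ i * toℕ (tape cf (+ suc i)))

enc : ∀ {k} → (Sym k → ℕ) → Config k → ℕ
enc π cf = π l ^ Lval cf * π (p (state cf)) * π h ^ Hval cf * π r ^ Rval cf

flipB : Bit → Bit
flipB f0 = fsuc f0
flipB (fsuc _) = f0

bits : List Bit
bits = allFin 2

upairs : ∀ {A : Set} → List A → List (A × A)
upairs []       = []
upairs (x ∷ xs) = map (λ y → (x , y)) xs ++ upairs xs

mD : ∀ {k} → Dir → Bit → Sym k
mD dL = mL
mD dR = mR

-- The canonical blocks of P_M: one block per schematic rule, in order.
-- Within a block the order is immaterial (see IsPM).
blocks : (M : UTM) → (Sym (UTM.k M) → ℕ) → List (List Fraction)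
blocks M π =
    map kill (upairs G1 ++ upairs G2 ++ upairs (h ∷ h' ∷ []))
  ∷ map (λ x → (π (mL (flipB x)) * π l' , π (mL x) * π l ^ 2)) bits
  ∷ map (λ x → (π (mL (flipB x)) * π r' ^ 2 , π (mL x) * π r)) bits
  ∷ map (λ x → (π (mL (flipB x)) * π r' , π (mL x) * π h')) bits
  ∷ map (λ x → (π (mL (flipB x)) * π h , π (mL x) * π l)) bits
  ∷ map (λ x → (π (c f0) , π (mL x))) bits
  ∷ map (λ x → (π (mR (flipB x)) * π r' , π (mR x) * π r ^ 2)) bits
  ∷ map (λ x → (π (mR (flipB x)) * π l' ^ 2 , π (mR x) * π l)) bits
  ∷ map (λ x → (π (mR (flipB x)) * π l' , π (mR x) * π h')) bits
  ∷ map (λ x → (π (mR (flipB x)) * π h , π (mR x) * π r)) bits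
  ∷ map (λ x → (π (c f0) , π (mR x))) bits
  ∷ map (λ x → (π (c (flipB x)) * π l , π (c x) * π l')) bits
  ∷ map (λ x → (π (c (flipB x)) * π r , π (c x) * π r')) bits
  ∷ map (λ x → (1 , π (c x))) bits
  ∷ concatMap (λ q → rule57 q (π h) (UTM.δ M q (fsuc f0))) states
  ∷ map (λ q → (1 , π (p q) * π h)) states
  ∷ concatMap (λ q → rule57 q 1 (UTM.δ M q f0)) states
  ∷ []
  where
  K = UTM.k M
  states : List (Fin K)
  states = allFin K
  kill : Sym K × Sym K → Fraction
  kill (a , b) = (1 , π a * π b)
  G1 : List (Sym K)
  G1 = mL f0 ∷ mL (fsuc f0) ∷ mR f0 ∷ mR (fsuc f0) ∷ c f0 ∷ c (fsuc f0) ∷ []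
  G2 : List (Sym K)
  G2 = map p states
  rule57 : Fin K → ℕ → Maybe (Fin K × Bit × Dir) → List Fraction
  rule57 q extra nothing = []
  rule57 q extra (just (q' , s' , d)) =
    (π (p q') * π h' ^ toℕ s' * π (mD d f0) , π (p q) * extra) ∷ []

IsPM : (M : UTM) → (Sym (UTM.k M) → ℕ) → List Fraction → Set
IsPM M π P = Σ[ bs ∈ List (List Fraction) ]
  (Pointwise _↭_ bs (blocks M π) × P ≡ concat bs)

-- Every number met while simulating a step is l^L l'^L′ r^R r'^R′ h^H h'^H′ · p_q · z with at most
-- one control prime z ∈ {m_{L,x}, m_{R,x}, c_x}, so the fractions of rule (1) never apply. Every other
-- fraction has in its denominator a prime missing from the number and from its own numerator, except
-- the one fraction meant to fire: the control prime selects the block, the bit x of the control, which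
-- flips at each firing, blocks the sibling fraction, and vanishing or small exponents block the earlier
-- fractions of the phase. Rule (5) or (7) consumes p_q (and h),
-- keeps the written bit in h' and starts phase (2) or (3). This halves the tape half on the side of the
-- move into l' or r', its parity becoming the new head h, and doubles the other half into r' or l',
-- adding the written bit. Rule (4) then moves l' and r' back to l and r. In a normal form no fraction
-- applies, possibly after rule (6) has erased p_q h.

module Submission where

open import Defs
open import Data.Empty using (⊥; ⊥-elim)
open import Data.Fin using (Fin; toℕ; #_) renaming (zero to f0; suc to fsuc)
import Data.Fin as Fin
open import Data.Fin.Properties using (toℕ<n)
open import Data.Integer as ℤ using (ℤ; +_; -[1+_]; ∣_∣)
open import Data.List using (List; []; _∷_; _++_; map; concat; concatMap; allFin; lookup)
open import Data.List.Membership.Propositional using (_∈_)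
open import Data.List.Membership.Propositional.Properties using (∈-concatMap⁺; ∈-concatMap⁻; ∈-allFin)
open import Data.List.Relation.Binary.Permutation.Propositional using (_↭_; ↭-sym)
open import Data.List.Relation.Binary.Permutation.Propositional.Properties using (All-resp-↭; Any-resp-↭)
open import Data.List.Relation.Binary.Pointwise using (Pointwise; []; _∷_)
open import Data.List.Relation.Unary.All using (All; []; _∷_)
import Data.List.Relation.Unary.All as All
import Data.List.Relation.Unary.All.Properties as All
open import Data.List.Relation.Unary.AllPairs using (AllPairs; []; _∷_)
import Data.List.Relation.Unary.AllPairs as AllPairs
open import Data.List.Relation.Unary.AllPairs.Properties using () renaming (map⁺ to AllPairs-map⁺)
open import Data.List.Relation.Unary.Any using (Any; here; there)
import Data.List.Relation.Unary.Any as Any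
open import Data.List.Relation.Unary.Any.Properties using () renaming (map⁺ to Any-map⁺)
open import Data.List.Relation.Unary.Unique.Propositional.Properties using (allFin⁺)
open import Data.Maybe using (Maybe; just; nothing)
open import Data.Nat using (ℕ; zero; suc; _+_; _*_; _^_; _≤_; _<_; z≤n; s≤s)
open import Data.Nat.Divisibility using (_∣_; _∤_; ∣-refl; ∣-trans; ∣1⇒≡1; m∣m*n; n∣m*n; *-cancelˡ-∣)
open import Data.Nat.Primality using (Prime; ¬prime[1]; euclidsLemma; prime⇒irreducible; prime⇒nonZero)
open import Data.Nat.Properties
open import Data.Nat.Tactic.RingSolver using (solve-∀)
open import Data.Product using (_×_; _,_; Σ-syntax; proj₁; proj₂)
open import Data.Sum using (_⊎_; inj₁; inj₂)
open import Data.Unit using (⊤; tt)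
open import Function.Base using (_∋_; case_of_)
open import Function.Definitions using (Injective)
open import Relation.Binary.Construct.Closure.ReflexiveTransitive using (Star; ε; _◅_; _◅◅_)
open import Relation.Binary.Definitions using (DecidableEquality)
open import Relation.Binary.PropositionalEquality using (_≡_; _≢_; refl; sym; trans; cong; cong₂; subst; module ≡-Reasoning)
open import Relation.Nullary using (¬_; yes; no)
import Relation.Nullary.Decidable as Dec

-- Fractran, one block of interchangeable fractions at a time

-- A record rather than a negation, so that n can be read off its type during elaboration.
record Inapplicable (n : ℕ) (f : Fraction) : Set where
  constructor inapplicable
  field not-integral : ¬ (proj₂ f ∣ n * proj₁ f)
open Inapplicable

Yields : ℕ → ℕ → Fraction → Set
Yields n m f = m * proj₂ f ≡ n * proj₁ f

-- Every applicable fraction of the block yields m, so the order of the block is immaterial.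
record BlockFires (n m : ℕ) (B : List Fraction) : Set where
  constructor _,_
  field
    admissible : All (λ f → Inapplicable n f ⊎ Yields n m f) B
    fires      : Any (Yields n m) B

data FirstFiring (n m : ℕ) : List (List Fraction) → Set where
  skip : ∀ {B Bs} → All (Inapplicable n) B → FirstFiring n m Bs → FirstFiring n m (B ∷ Bs)
  fire : ∀ {B Bs} → BlockFires n m B → FirstFiring n m (B ∷ Bs)

skip-blocks : ∀ {n m As Bs} → All (All (Inapplicable n)) As → FirstFiring n m Bs → FirstFiring n m (As ++ Bs)
skip-blocks []         ff = ff
skip-blocks (na ∷ nas) ff = skip na (skip-blocks nas ff)

private
  skip-block : ∀ {n m P} B → All (Inapplicable n) B → FStep P n m → FStep (B ++ P) n m
  skip-block []      []         st = st
  skip-block (_ ∷ B) (na ∷ nas) st = there (not-integral na) (skip-block B nas st)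

  fire-first : ∀ {n m P} B → BlockFires n m B → FStep (B ++ P) n m
  fire-first (_ ∷ _) (_            ∷ _  , here y)  = here y
  fire-first (_ ∷ _) (inj₂ y       ∷ _  , there _) = here y
  fire-first (_ ∷ B) (inj₁ na      ∷ gs , there a) = there (not-integral na) (fire-first B (gs , a))

firstFiring⇒FStep : ∀ {n m} bs Bs → Pointwise _↭_ bs Bs → FirstFiring n m Bs → FStep (concat bs) n m
firstFiring⇒FStep {n} (b ∷ bs) (B ∷ Bs) (b↭B ∷ bs∼Bs) (skip nas ff) =
  skip-block b (All-resp-↭ {P = Inapplicable n} (↭-sym b↭B) nas) (firstFiring⇒FStep bs Bs bs∼Bs ff)
firstFiring⇒FStep (b ∷ bs) (B ∷ Bs) (b↭B ∷ bs∼Bs) (fire (gs , y)) =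
  fire-first b (All-resp-↭ (↭-sym b↭B) gs , Any-resp-↭ (↭-sym b↭B) y)

allInapplicable⇒Undefined : ∀ {n} bs Bs → Pointwise _↭_ bs Bs → All (All (Inapplicable n)) Bs → Undefined (concat bs) n
allInapplicable⇒Undefined {n} bs Bs bs∼Bs nas = All.map not-integral (All.concat⁺ (permuted bs Bs bs∼Bs nas))
  where
  permuted : ∀ bs Bs → Pointwise _↭_ bs Bs → All (All (Inapplicable n)) Bs → All (All (Inapplicable n)) bs
  permuted []       []       []             []         = []
  permuted (b ∷ bs) (B ∷ Bs) (b↭B ∷ bs∼Bs) (na ∷ nas) =
    All-resp-↭ {P = Inapplicable n} (↭-sym b↭B) na ∷ permuted bs Bs bs∼Bs nas

upairs-AllPairs : ∀ {A : Set} {R : A → A → Set} {xs} → AllPairs R xs → All (λ ab → R (proj₁ ab) (proj₂ ab)) (upairs xs)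
upairs-AllPairs []         = []
upairs-AllPairs (rs ∷ rss) = All.++⁺ (All.map⁺ rs) (upairs-AllPairs rss)

-- Divisibility by a prime

module _ {p : ℕ} (prime : Prime p) where

  prime∤1 : p ∤ 1
  prime∤1 p∣1 = ¬prime[1] (subst Prime (∣1⇒≡1 p∣1) prime)

  prime∤* : ∀ {m n} → p ∤ m → p ∤ n → p ∤ m * n
  prime∤* {m} {n} p∤m p∤n p∣mn with euclidsLemma m n prime p∣mn
  ... | inj₁ p∣m = p∤m p∣m
  ... | inj₂ p∣n = p∤n p∣n

  prime∤^ : ∀ {m} k → p ∤ m → p ∤ m ^ k
  prime∤^ zero    _   = prime∤1
  prime∤^ (suc k) p∤m = prime∤* p∤m (prime∤^ k p∤m)

  prime∤prime : ∀ {q} → Prime q → p ≢ q → p ∤ q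
  prime∤prime q-prime p≢q p∣q with prime⇒irreducible q-prime p∣q
  ... | inj₁ p≡1 = ¬prime[1] (subst Prime p≡1 prime)
  ... | inj₂ p≡q = p≢q p≡q

  inapplicable-by-absent : ∀ {n a b} → p ∣ b → p ∤ n → p ∤ a → Inapplicable n (a , b)
  inapplicable-by-absent p∣b p∤n p∤a = inapplicable λ b∣na → prime∤* p∤n p∤a (∣-trans p∣b b∣na)

  prime^∤ : ∀ {y} e {k} → p ∤ y → e < k → p ^ k ∤ p ^ e * y
  prime^∤ {y} zero    {suc k} p∤y _          pᵏ∣y = p∤y (∣-trans (m∣m*n (p ^ k)) (subst (p ^ suc k ∣_) (*-identityˡ y) pᵏ∣y))
  prime^∤ {y} (suc e) {suc k} p∤y (s≤s e<k) pᵏ∣pᵉy =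
    prime^∤ e p∤y e<k (*-cancelˡ-∣ p {{prime⇒nonZero prime}} (subst (p ^ suc k ∣_) (*-assoc p (p ^ e) y) pᵏ∣pᵉy))

  inapplicable-by-power : ∀ {y a b} e {k} → p ^ k ∣ b → e < k → p ∤ y → p ∤ a → Inapplicable (p ^ e * y) (a , b)
  inapplicable-by-power {y} {a} {b} e pᵏ∣b e<k p∤y p∤a = inapplicable λ b∣pᵉya →
    prime^∤ e (prime∤* p∤y p∤a) e<k (∣-trans pᵏ∣b (subst (b ∣_) (*-assoc (p ^ e) y a) b∣pᵉya))

-- Tapes as pairs of binary numbers

double : ℕ → ℕ
double zero    = zero
double (suc k) = suc (suc (double k))

double≡+ : ∀ k → double k ≡ k + k
double≡+ zero    = refl
double≡+ (suc k) = cong suc (trans (cong suc (double≡+ k)) (sym (+-suc k k)))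

double-+2 : ∀ k d → double k + suc (suc d) ≡ suc (suc (double k + d))
double-+2 k d = trans (+-suc (double k) (suc d)) (cong suc (+-suc (double k) d))

binary : ℕ → (ℕ → Bit) → ℕ
binary B u = sumTo B (λ i → 2 ^ i * toℕ (u i))

Vanishes : ℕ → (ℕ → Bit) → Set
Vanishes B u = ∀ i → B ≤ i → u i ≡ f0

sumTo-cong : ∀ B {f g : ℕ → ℕ} → (∀ i → f i ≡ g i) → sumTo B f ≡ sumTo B g
sumTo-cong zero    f≗g = refl
sumTo-cong (suc B) f≗g = cong₂ _+_ (sumTo-cong B f≗g) (f≗g B)

binary-pad : ∀ {B u} → Vanishes B u → ∀ k → binary (k + B) u ≡ binary B u
binary-pad             u≡0 zero    = refl
binary-pad {B} {u} u≡0 (suc k) = begin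
  binary (k + B) u + 2 ^ (k + B) * toℕ (u (k + B))
    ≡⟨ cong₂ _+_ (binary-pad u≡0 k) (cong (λ b → 2 ^ (k + B) * toℕ b) (u≡0 (k + B) (m≤n+m B k))) ⟩
  binary B u + 2 ^ (k + B) * 0                       ≡⟨ cong (_+_ (binary B u)) (*-zeroʳ (2 ^ (k + B))) ⟩
  binary B u + 0                                     ≡⟨ +-identityʳ _ ⟩
  binary B u                                         ∎
  where open ≡-Reasoning

binary-suc : ∀ B u → binary (suc B) u ≡ toℕ (u 0) + double (binary B (λ i → u (suc i)))
binary-suc zero    u = refl
binary-suc (suc B) u = begin
  binary (suc B) u + 2 ^ suc B * x                 ≡⟨ cong (_+ 2 ^ suc B * x) (binary-suc B u) ⟩
  toℕ (u 0) + double S + 2 * 2 ^ B * x             ≡⟨ cong (λ d → toℕ (u 0) + d + 2 * 2 ^ B * x) (double≡+ S) ⟩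
  toℕ (u 0) + (S + S) + 2 * 2 ^ B * x              ≡⟨ regroup (toℕ (u 0)) S (2 ^ B) x ⟩
  toℕ (u 0) + (S + 2 ^ B * x + (S + 2 ^ B * x))    ≡⟨ cong (_+_ (toℕ (u 0))) (sym (double≡+ (S + 2 ^ B * x))) ⟩
  toℕ (u 0) + double (S + 2 ^ B * x)               ∎
  where
  open ≡-Reasoning
  S = binary B (λ i → u (suc i))
  x = toℕ (u (suc B))
  regroup : ∀ a s e x → a + (s + s) + 2 * e * x ≡ a + (s + e * x + (s + e * x))
  regroup = solve-∀

binary-shift : ∀ {B B' u v b} → Vanishes B u → Vanishes B' v → u 0 ≡ b → (∀ i → u (suc i) ≡ v i) →
               binary B u ≡ toℕ b + double (binary B' v)
binary-shift {B} {B'} {u} {v} {b} u≡0 v≡0 u0≡b u∘suc≗v = begin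
  binary B u                                       ≡⟨ sym (binary-pad u≡0 (suc B')) ⟩
  binary (suc (B' + B)) u                          ≡⟨ binary-suc (B' + B) u ⟩
  toℕ (u 0) + double (binary (B' + B) (λ i → u (suc i)))
    ≡⟨ cong₂ (λ a w → toℕ a + double w) u0≡b (sumTo-cong (B' + B) (λ i → cong (λ d → 2 ^ i * toℕ d) (u∘suc≗v i))) ⟩
  toℕ b + double (binary (B' + B) v)               ≡⟨ cong (λ C → toℕ b + double (binary C v)) (+-comm B' B) ⟩
  toℕ b + double (binary (B + B') v)               ≡⟨ cong (λ w → toℕ b + double w) (binary-pad v≡0 B) ⟩
  toℕ b + double (binary B' v)                     ∎
  where open ≡-Reasoning

module _ {k : ℕ} where

  leftTape rightTape : Config k → ℕ → Bit
  leftTape  cf i = tape cf -[1+ i ]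
  rightTape cf i = tape cf (+ suc i)

  leftTape-vanishes : ∀ cf → Vanishes (bound cf) (leftTape cf)
  leftTape-vanishes cf i B≤i = support cf -[1+ i ] (s≤s B≤i)

  rightTape-vanishes : ∀ cf → Vanishes (bound cf) (rightTape cf)
  rightTape-vanishes cf i B≤i = support cf (+ suc i) (s≤s B≤i)

  module _ {c c' : Config k} where

    Lval-stepL : (∀ n → n ≢ + 0 → tape c' (n ℤ.+ + 1) ≡ tape c n) → Lval c ≡ Hval c' + double (Lval c')
    Lval-stepL shift = binary-shift (leftTape-vanishes c) (leftTape-vanishes c')
      (sym (shift -[1+ 0 ] (λ ()))) (λ i → sym (shift -[1+ suc i ] (λ ())))

    Rval-stepL : ∀ {f} → tape c' (+ 1) ≡ f → (∀ n → n ≢ + 0 → tape c' (n ℤ.+ + 1) ≡ tape c n) → Rval c' ≡ toℕ f + double (Rval c)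
    Rval-stepL written shift = binary-shift (rightTape-vanishes c') (rightTape-vanishes c) written
      (λ i → subst (λ j → tape c' (+ suc j) ≡ tape c (+ suc i)) (+-comm i 1) (shift (+ suc i) (λ ())))

    Rval-stepR : (∀ n → n ≢ + 0 → tape c' (n ℤ.- + 1) ≡ tape c n) → Rval c ≡ Hval c' + double (Rval c')
    Rval-stepR shift = binary-shift (rightTape-vanishes c) (rightTape-vanishes c')
      (sym (shift (+ 1) (λ ()))) (λ i → sym (shift (+ suc (suc i)) (λ ())))

    Lval-stepR : ∀ {f} → tape c' -[1+ 0 ] ≡ f → (∀ n → n ≢ + 0 → tape c' (n ℤ.- + 1) ≡ tape c n) → Lval c' ≡ toℕ f + double (Lval c)
    Lval-stepR written shift = binary-shift (leftTape-vanishes c') (leftTape-vanishes c) written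
      (λ i → subst (λ j → tape c' -[1+ suc j ] ≡ tape c -[1+ i ]) (+-identityʳ i) (shift -[1+ i ] (λ ())))

module _ {k : ℕ} (cf : Config k) (q : Fin k) (s : Bit) where

  movedLeft : Config k
  movedLeft = record { state = q ; tape = τ ; bound = suc (bound cf) ; support = vanishes }
    where
    τ : ℤ → Bit
    τ (+ zero)          = tape cf -[1+ 0 ]
    τ (+ suc zero)      = s
    τ (+ suc (suc j))   = tape cf (+ suc j)
    τ -[1+ j ]          = tape cf -[1+ suc j ]
    vanishes : ∀ i → suc (bound cf) < ∣ i ∣ → τ i ≡ f0
    vanishes (+ suc (suc j)) (s≤s B<j) = support cf (+ suc j) B<j
    vanishes -[1+ j ]        (s≤s B<j) = support cf -[1+ suc j ] (m<n⇒m<1+n (m<n⇒m<1+n B<j))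
    vanishes (+ suc zero)    (s≤s ())

  movedLeft-shift : ∀ n → n ≢ + 0 → tape movedLeft (n ℤ.+ + 1) ≡ tape cf n
  movedLeft-shift (+ zero)     n≢0 = ⊥-elim (n≢0 refl)
  movedLeft-shift (+ suc j)    _   rewrite +-comm j 1 = refl
  movedLeft-shift -[1+ zero ]  _   = refl
  movedLeft-shift -[1+ suc j ] _   = refl

  movedRight : Config k
  movedRight = record { state = q ; tape = τ ; bound = suc (bound cf) ; support = vanishes }
    where
    τ : ℤ → Bit
    τ (+ j)         = tape cf (+ suc j)
    τ -[1+ zero ]   = s
    τ -[1+ suc j ]  = tape cf -[1+ j ]
    vanishes : ∀ i → suc (bound cf) < ∣ i ∣ → τ i ≡ f0
    vanishes (+ j)          B<j       = support cf (+ suc j) (m<n⇒m<1+n (<-trans (n<1+n _) B<j))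
    vanishes -[1+ suc j ]   (s≤s B<j) = support cf -[1+ j ] B<j
    vanishes -[1+ zero ]    (s≤s ())

  movedRight-shift : ∀ n → n ≢ + 0 → tape movedRight (n ℤ.- + 1) ≡ tape cf n
  movedRight-shift (+ zero)  n≢0 = ⊥-elim (n≢0 refl)
  movedRight-shift (+ suc j) _   = refl
  movedRight-shift -[1+ j ]  _   rewrite +-identityʳ j = refl

module Simulation (M : UTM) (no-self-loop : NoSelfLoop M)
                  (π : Sym (UTM.k M) → ℕ) (π-prime : ∀ s → Prime (π s)) (π-injective : Injective _≡_ _≡_ π)
                  (P : List Fraction) (P-is-PM : IsPM M π P) where

  K : ℕ
  K = UTM.k M

  δ : Fin K → Bit → Maybe (Fin K × Bit × Dir)
  δ = UTM.δ M

  _≟ₛ_ : DecidableEquality (Sym K)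
  s ≟ₛ t = Dec.map′ π-injective (cong π) (π s ≟ π t)

  π∤π : ∀ {s t} → s ≢ t → π s ∤ π t
  π∤π s≢t = prime∤prime (π-prime _) (π-prime _) (λ πs≡πt → s≢t (π-injective πs≡πt))

  π∤π^ : ∀ {s t} k → (s ≡ t → k ≡ 0) → π s ∤ π t ^ k
  π∤π^ {s} {t} k s≡t⇒k≡0 with s ≟ₛ t
  ... | yes refl rewrite s≡t⇒k≡0 refl = prime∤1 (π-prime s)
  ... | no s≢t   = prime∤^ (π-prime s) k (π∤π s≢t)

  π∤* : ∀ {s m n} → π s ∤ m → π s ∤ n → π s ∤ m * n
  π∤* = prime∤* (π-prime _)

  p-injective : ∀ {t u} → p {K} t ≡ p u → t ≡ u
  p-injective refl = refl

  record Regs : Set where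
    constructor regs
    field L L′ R R′ H H′ : ℕ
  open Regs

  val : Regs → ℕ
  val ρ = π l ^ L ρ * π l' ^ L′ ρ * π r ^ R ρ * π r' ^ R′ ρ * π h ^ H ρ * π h' ^ H′ ρ

  exponent : Regs → Sym K → ℕ
  exponent ρ l  = L ρ
  exponent ρ l' = L′ ρ
  exponent ρ r  = R ρ
  exponent ρ r' = R′ ρ
  exponent ρ h  = H ρ
  exponent ρ h' = H′ ρ
  exponent ρ _  = 0

  val-absent : ∀ {s} ρ → exponent ρ s ≡ 0 → π s ∤ val ρ
  val-absent ρ e≡0 =
    π∤* (π∤* (π∤* (π∤* (π∤* (π∤π^ (L ρ) λ { refl → e≡0 }) (π∤π^ (L′ ρ) λ { refl → e≡0 }))
      (π∤π^ (R ρ) λ { refl → e≡0 })) (π∤π^ (R′ ρ) λ { refl → e≡0 }))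
      (π∤π^ (H ρ) λ { refl → e≡0 })) (π∤π^ (H′ ρ) λ { refl → e≡0 })

  data Register : Sym K → Set where
    l  : Register l
    l' : Register l'
    r  : Register r
    r' : Register r'
    h  : Register h
    h' : Register h'

  bump : ∀ {s} → Register s → ℕ → Regs → Regs
  bump l  k ρ = record ρ { L  = k + L ρ }
  bump l' k ρ = record ρ { L′ = k + L′ ρ }
  bump r  k ρ = record ρ { R  = k + R ρ }
  bump r' k ρ = record ρ { R′ = k + R′ ρ }
  bump h  k ρ = record ρ { H  = k + H ρ }
  bump h' k ρ = record ρ { H′ = k + H′ ρ }

  clear : ∀ {s} → Register s → Regs → Regs
  clear l  ρ = record ρ { L  = 0 }
  clear l' ρ = record ρ { L′ = 0 }
  clear r  ρ = record ρ { R  = 0 }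
  clear r' ρ = record ρ { R′ = 0 }
  clear h  ρ = record ρ { H  = 0 }
  clear h' ρ = record ρ { H′ = 0 }

  exponent-clear : ∀ {s} (i : Register s) ρ → exponent (clear i ρ) s ≡ 0
  exponent-clear l  ρ = refl
  exponent-clear l' ρ = refl
  exponent-clear r  ρ = refl
  exponent-clear r' ρ = refl
  exponent-clear h  ρ = refl
  exponent-clear h' ρ = refl

  bump-spec : ∀ {s} (i : Register s) k ρ → exponent (bump i k ρ) s ≡ k + exponent ρ s × clear i (bump i k ρ) ≡ clear i ρ
  bump-spec l  k ρ = refl , refl
  bump-spec l' k ρ = refl , refl
  bump-spec r  k ρ = refl , refl
  bump-spec r' k ρ = refl , refl
  bump-spec h  k ρ = refl , refl
  bump-spec h' k ρ = refl , refl

  val-factor : ∀ {s} (i : Register s) ρ → val ρ ≡ π s ^ exponent ρ s * val (clear i ρ)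
  val-factor l  ρ = first (π l ^ L ρ) (π l' ^ L′ ρ) (π r ^ R ρ) (π r' ^ R′ ρ) (π h ^ H ρ) (π h' ^ H′ ρ)
    where first : ∀ a b c d e f → a * b * c * d * e * f ≡ a * (1 * b * c * d * e * f)
          first = solve-∀
  val-factor l' ρ = second (π l ^ L ρ) (π l' ^ L′ ρ) (π r ^ R ρ) (π r' ^ R′ ρ) (π h ^ H ρ) (π h' ^ H′ ρ)
    where second : ∀ a b c d e f → a * b * c * d * e * f ≡ b * (a * 1 * c * d * e * f)
          second = solve-∀
  val-factor r  ρ = third (π l ^ L ρ) (π l' ^ L′ ρ) (π r ^ R ρ) (π r' ^ R′ ρ) (π h ^ H ρ) (π h' ^ H′ ρ)
    where third : ∀ a b c d e f → a * b * c * d * e * f ≡ c * (a * b * 1 * d * e * f)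
          third = solve-∀
  val-factor r' ρ = fourth (π l ^ L ρ) (π l' ^ L′ ρ) (π r ^ R ρ) (π r' ^ R′ ρ) (π h ^ H ρ) (π h' ^ H′ ρ)
    where fourth : ∀ a b c d e f → a * b * c * d * e * f ≡ d * (a * b * c * 1 * e * f)
          fourth = solve-∀
  val-factor h  ρ = fifth (π l ^ L ρ) (π l' ^ L′ ρ) (π r ^ R ρ) (π r' ^ R′ ρ) (π h ^ H ρ) (π h' ^ H′ ρ)
    where fifth : ∀ a b c d e f → a * b * c * d * e * f ≡ e * (a * b * c * d * 1 * f)
          fifth = solve-∀
  val-factor h' ρ = sixth (π l ^ L ρ) (π l' ^ L′ ρ) (π r ^ R ρ) (π r' ^ R′ ρ) (π h ^ H ρ) (π h' ^ H′ ρ)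
    where sixth : ∀ a b c d e f → a * b * c * d * e * f ≡ f * (a * b * c * d * e * 1)
          sixth = solve-∀

  val-bump : ∀ {s} (i : Register s) k ρ → val (bump i k ρ) ≡ π s ^ k * val ρ
  val-bump {s} i k ρ = begin
    val (bump i k ρ)                                       ≡⟨ val-factor i (bump i k ρ) ⟩
    π s ^ exponent (bump i k ρ) s * val (clear i (bump i k ρ))
      ≡⟨ cong₂ (λ e σ → π s ^ e * val σ) (proj₁ (bump-spec i k ρ)) (proj₂ (bump-spec i k ρ)) ⟩
    π s ^ (k + exponent ρ s) * val (clear i ρ)             ≡⟨ cong (_* val (clear i ρ)) (^-distribˡ-+-* (π s) k _) ⟩
    π s ^ k * π s ^ exponent ρ s * val (clear i ρ)         ≡⟨ *-assoc (π s ^ k) _ _ ⟩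
    π s ^ k * (π s ^ exponent ρ s * val (clear i ρ))       ≡⟨ cong (π s ^ k *_) (sym (val-factor i ρ)) ⟩
    π s ^ k * val ρ                                        ∎
    where open ≡-Reasoning

  register-inapplicable : ∀ {s} (i : Register s) ρ {k W a b} → π s ^ k ∣ b → exponent ρ s < k → π s ∤ W → π s ∤ a →
                          Inapplicable (val ρ * W) (a , b)
  register-inapplicable {s} i ρ {k} {W} {a} {b} sᵏ∣b e<k s∤W s∤a =
    subst (λ n → Inapplicable n (a , b)) (sym (trans (cong (_* W) (val-factor i ρ)) (*-assoc (π s ^ exponent ρ s) (val (clear i ρ)) W)))
      (inapplicable-by-power (π-prime s) (exponent ρ s) sᵏ∣b e<k (π∤* (val-absent (clear i ρ) (exponent-clear i ρ)) s∤W) s∤a)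

  yields-transfer : ∀ {s t} (i : Register s) (j : Register t) a b ρ q X X' {A B} → π t ^ b ≡ A → π s ^ a ≡ B →
                    Yields (val (bump i a ρ) * (π (p q) * π X)) (val (bump j b ρ) * (π (p q) * π X')) (π X' * A , π X * B)
  yields-transfer {s} {t} i j a b ρ q X X' refl refl
    rewrite val-bump i a ρ | val-bump j b ρ = swap (π t ^ b) (π s ^ a) (val ρ) (π (p q)) (π X) (π X')
    where swap : ∀ A B V W X X' → A * V * (W * X') * (X * B) ≡ B * V * (W * X) * (X' * A)
          swap = solve-∀

  infix 4 _⟶_ _⟶*_

  _⟶_ : ℕ → ℕ → Set
  n ⟶ m = FStep P n m

  _⟶*_ : ℕ → ℕ → Set
  _⟶*_ = Star _⟶_

  step : ∀ {n m} → FirstFiring n m (blocks M π) → n ⟶ m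
  step {n} {m} ff = subst (λ Q → FStep Q n m) (sym P≡) (firstFiring⇒FStep bs (blocks M π) bs∼blocks ff)
    where bs = proj₁ P-is-PM ; bs∼blocks = proj₁ (proj₂ P-is-PM) ; P≡ = proj₂ (proj₂ P-is-PM)

  halted : ∀ {n} → All (All (Inapplicable n)) (blocks M π) → Undefined P n
  halted {n} nas = subst (λ Q → Undefined Q n) (sym P≡) (allInapplicable⇒Undefined {n} bs (blocks M π) bs∼blocks nas)
    where bs = proj₁ P-is-PM ; bs∼blocks = proj₁ (proj₂ P-is-PM) ; P≡ = proj₂ (proj₂ P-is-PM)

  -- Rule (1): at most one symbol of each group may be present

  Control : Sym K → Set
  Control (mL _) = ⊤
  Control (mR _) = ⊤
  Control (c _)  = ⊤
  Control _      = ⊥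

  controls states : List (Sym K)
  controls = mL f0 ∷ mL (fsuc f0) ∷ mR f0 ∷ mR (fsuc f0) ∷ c f0 ∷ c (fsuc f0) ∷ []
  states   = map p (allFin K)

  All-controls : ∀ {Q : Sym K → Set} → (∀ {s} → Control s → Q s) → All Q controls
  All-controls q = q tt ∷ q tt ∷ q tt ∷ q tt ∷ q tt ∷ q tt ∷ []

  controls-distinct : AllPairs _≢_ controls
  controls-distinct = ((λ ()) ∷ (λ ()) ∷ (λ ()) ∷ (λ ()) ∷ (λ ()) ∷ []) ∷ ((λ ()) ∷ (λ ()) ∷ (λ ()) ∷ (λ ()) ∷ [])
                    ∷ ((λ ()) ∷ (λ ()) ∷ (λ ()) ∷ []) ∷ ((λ ()) ∷ (λ ()) ∷ []) ∷ ((λ ()) ∷ []) ∷ [] ∷ []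

  states-distinct : AllPairs _≢_ states
  states-distinct = AllPairs-map⁺ (AllPairs.map (λ t≢u pt≡pu → t≢u (p-injective pt≡pu)) (allFin⁺ K))

  kill : Sym K × Sym K → Fraction
  kill (s , t) = (1 , π s * π t)

  killBlock : List Fraction
  killBlock = map kill (upairs controls ++ upairs states ++ upairs (h ∷ h' ∷ []))

  AtMostOnePresent : ℕ → List (Sym K) → Set
  AtMostOnePresent n = AllPairs (λ s t → π s ∤ n ⊎ π t ∤ n)

  only-present : ∀ {n z G} → AllPairs _≢_ G → All (λ s → s ≢ z → π s ∤ n) G → AtMostOnePresent n G
  only-present {n} {z} []             []               = []
  only-present {n} {z} (s≢G ∷ G-dist) (s-absent ∷ G-absent) =
    All.zipWith (one-absent s-absent) (s≢G , G-absent) ∷ only-present G-dist G-absent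
    where
    one-absent : ∀ {s t} → (s ≢ z → π s ∤ n) → s ≢ t × (t ≢ z → π t ∤ n) → π s ∤ n ⊎ π t ∤ n
    one-absent {s} s-absent (s≢t , t-absent) with s ≟ₛ z
    ... | yes refl = inj₂ (t-absent (λ t≡s → s≢t (sym t≡s)))
    ... | no s≢z   = inj₁ (s-absent s≢z)

  none-present : ∀ {n G} → All (λ s → π s ∤ n) G → AtMostOnePresent n G
  none-present []            = []
  none-present (s∤n ∷ G∤n) = All.map (λ _ → inj₁ s∤n) G∤n ∷ none-present G∤n

  killBlock-inapplicable : ∀ {n} → AtMostOnePresent n controls → AtMostOnePresent n states → π h ∤ n ⊎ π h' ∤ n →
                           All (Inapplicable n) killBlock
  killBlock-inapplicable {n} ctl st hh = All.map⁺ (All.++⁺ (kills ctl) (All.++⁺ (kills st) (kills ((hh ∷ []) ∷ [] ∷ []))))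
    where
    kills : ∀ {G} → AtMostOnePresent n G → All (λ st → Inapplicable n (kill st)) (upairs G)
    kills amo = All.map absent (upairs-AllPairs amo)
      where
      absent : ∀ {st} → π (proj₁ st) ∤ n ⊎ π (proj₂ st) ∤ n → Inapplicable n (kill st)
      absent {s , t} (inj₁ s∤n) = inapplicable-by-absent (π-prime s) (m∣m*n (π t)) s∤n (prime∤1 (π-prime s))
      absent {s , t} (inj₂ t∤n) = inapplicable-by-absent (π-prime t) (n∣m*n (π s)) t∤n (prime∤1 (π-prime t))

  -- Rules (2)–(4): blocks indexed by a bit, keyed by a control symbol

  halveL doubleR writeR readL finishL halveR doubleL writeL readR finishR restoreL restoreR finishCopy : Bit → Fraction
  halveL     x = (π (mL (flipB x)) * π l' ,     π (mL x) * π l ^ 2)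
  doubleR    x = (π (mL (flipB x)) * π r' ^ 2 , π (mL x) * π r)
  writeR     x = (π (mL (flipB x)) * π r' ,     π (mL x) * π h')
  readL      x = (π (mL (flipB x)) * π h ,      π (mL x) * π l)
  finishL    x = (π (c f0) ,                    π (mL x))
  halveR     x = (π (mR (flipB x)) * π r' ,     π (mR x) * π r ^ 2)
  doubleL    x = (π (mR (flipB x)) * π l' ^ 2 , π (mR x) * π l)
  writeL     x = (π (mR (flipB x)) * π l' ,     π (mR x) * π h')
  readR      x = (π (mR (flipB x)) * π h ,      π (mR x) * π r)
  finishR    x = (π (c f0) ,                    π (mR x))
  restoreL   x = (π (c (flipB x)) * π l ,       π (c x) * π l')
  restoreR   x = (π (c (flipB x)) * π r ,       π (c x) * π r')
  finishCopy x = (1 ,                           π (c x))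

  Keyed : (Bit → Sym K) → (Bit → Fraction) → Set
  Keyed key F = ∀ y {n} → π (key y) ∤ n → Inapplicable n (F y)

  keyed : ∀ {key F} → (∀ y → π (key y) ∣ proj₂ (F y)) → (∀ y → π (key y) ∤ proj₁ (F y)) → Keyed key F
  keyed key∣den key∤num y key∤n = inapplicable-by-absent (π-prime _) (key∣den y) key∤n (key∤num y)

  module _ {key F} (F-keyed : Keyed key F) where

    keyed-absent : ∀ {n} → (∀ y → π (key y) ∤ n) → All (Inapplicable n) (map F bits)
    keyed-absent keys∤n = F-keyed f0 (keys∤n f0) ∷ F-keyed (fsuc f0) (keys∤n (fsuc f0)) ∷ []

    keyed-skip : ∀ x {n} → Inapplicable n (F x) → π (key (flipB x)) ∤ n → All (Inapplicable n) (map F bits)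
    keyed-skip f0        Fx other = Fx ∷ F-keyed (fsuc f0) other ∷ []
    keyed-skip (fsuc f0) Fx other = F-keyed f0 other ∷ Fx ∷ []

    keyed-fire : ∀ x {n m} → Yields n m (F x) → π (key (flipB x)) ∤ n → BlockFires n m (map F bits)
    keyed-fire f0        Fx other = (inj₂ Fx ∷ inj₁ (F-keyed (fsuc f0) other) ∷ []) , here Fx
    keyed-fire (fsuc f0) Fx other = (inj₁ (F-keyed f0 other) ∷ inj₂ Fx ∷ []) , there (here Fx)

  key≢flip : ∀ {key : Bit → Sym K} → key f0 ≢ key (fsuc f0) → ∀ x → key x ≢ key (flipB x)
  key≢flip key0≢key1 f0        = key0≢key1
  key≢flip key0≢key1 (fsuc f0) = λ key1≡key0 → key0≢key1 (sym key1≡key0)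

  private
    π∤flip* : ∀ {key : Bit → Sym K} {a} → key f0 ≢ key (fsuc f0) → (∀ {y} → π (key y) ∤ a) → ∀ y → π (key y) ∤ π (key (flipB y)) * a
    π∤flip* {key} key0≢key1 key∤a y = π∤* (π∤π (key≢flip {key} key0≢key1 y)) (key∤a {y})

  halveL-keyed : Keyed mL halveL
  halveL-keyed = keyed (λ _ → m∣m*n _) (π∤flip* (λ ()) (π∤π λ ()))

  doubleR-keyed : Keyed mL doubleR
  doubleR-keyed = keyed (λ _ → m∣m*n _) (π∤flip* (λ ()) (prime∤^ (π-prime _) 2 (π∤π λ ())))

  writeR-keyed : Keyed mL writeR
  writeR-keyed = keyed (λ _ → m∣m*n _) (π∤flip* (λ ()) (π∤π λ ()))

  readL-keyed : Keyed mL readL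
  readL-keyed = keyed (λ _ → m∣m*n _) (π∤flip* (λ ()) (π∤π λ ()))

  finishL-keyed : Keyed mL finishL
  finishL-keyed = keyed (λ _ → ∣-refl) (λ _ → π∤π λ ())

  halveR-keyed : Keyed mR halveR
  halveR-keyed = keyed (λ _ → m∣m*n _) (π∤flip* (λ ()) (π∤π λ ()))

  doubleL-keyed : Keyed mR doubleL
  doubleL-keyed = keyed (λ _ → m∣m*n _) (π∤flip* (λ ()) (prime∤^ (π-prime _) 2 (π∤π λ ())))

  writeL-keyed : Keyed mR writeL
  writeL-keyed = keyed (λ _ → m∣m*n _) (π∤flip* (λ ()) (π∤π λ ()))

  readR-keyed : Keyed mR readR
  readR-keyed = keyed (λ _ → m∣m*n _) (π∤flip* (λ ()) (π∤π λ ()))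

  finishR-keyed : Keyed mR finishR
  finishR-keyed = keyed (λ _ → ∣-refl) (λ _ → π∤π λ ())

  restoreL-keyed : Keyed c restoreL
  restoreL-keyed = keyed (λ _ → m∣m*n _) (π∤flip* (λ ()) (π∤π λ ()))

  restoreR-keyed : Keyed c restoreR
  restoreR-keyed = keyed (λ _ → m∣m*n _) (π∤flip* (λ ()) (π∤π λ ()))

  finishCopy-keyed : Keyed c finishCopy
  finishCopy-keyed = keyed (λ _ → ∣-refl) (λ _ → prime∤1 (π-prime _))

  atState : Fin K → Regs → ℕ
  atState q σ = val σ * π (p q)

  phase : Fin K → Sym K → Regs → ℕ
  phase q z σ = val σ * (π (p q) * π z)

  π∤π*π : ∀ {s a b} → s ≢ a → s ≢ b → π s ∤ π a * π b
  π∤π*π s≢a s≢b = π∤* (π∤π s≢a) (π∤π s≢b)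

  atState-absent : ∀ {q s} σ → exponent σ s ≡ 0 → s ≢ p q → π s ∤ atState q σ
  atState-absent σ e≡0 s≢q = π∤* (val-absent σ e≡0) (π∤π s≢q)

  phase-absent : ∀ {q z s} σ → exponent σ s ≡ 0 → s ≢ p q → s ≢ z → π s ∤ phase q z σ
  phase-absent σ e≡0 s≢q s≢z = π∤* (val-absent σ e≡0) (π∤π*π s≢q s≢z)

  control≢ : ∀ {s z} → Control z → ¬ Control s → s ≢ z
  control≢ z-control s-not-control refl = s-not-control z-control

  phase-control-absent : ∀ {q z s} σ → Control s → s ≢ z → π s ∤ phase q z σ
  phase-control-absent {s = mL _} σ _ = phase-absent σ refl (λ ())
  phase-control-absent {s = mR _} σ _ = phase-absent σ refl (λ ())
  phase-control-absent {s = c _}  σ _ = phase-absent σ refl (λ ())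

  phase-killBlock : ∀ {q z} σ → Control z → H σ ≡ 0 ⊎ H′ σ ≡ 0 → All (Inapplicable (phase q z σ)) killBlock
  phase-killBlock {q} {z} σ z-control H≡0⊎H′≡0 = killBlock-inapplicable
    (only-present controls-distinct (All-controls (phase-control-absent σ)))
    (only-present states-distinct (All.map⁺ (All.universal (λ t t≢q → phase-absent σ refl t≢q (control≢ z-control λ ())) (allFin K))))
    (head-absent H≡0⊎H′≡0)
    where
    head-absent : H σ ≡ 0 ⊎ H′ σ ≡ 0 → π h ∤ phase q z σ ⊎ π h' ∤ phase q z σ
    head-absent (inj₁ H≡0)  = inj₁ (phase-absent σ H≡0 (λ ()) (control≢ z-control λ ()))
    head-absent (inj₂ H′≡0) = inj₂ (phase-absent σ H′≡0 (λ ()) (control≢ z-control λ ()))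

  Reach : ℕ → (Bit → ℕ) → Set
  Reach n target = Σ[ x ∈ Bit ] n ⟶* target x

  ⟶*-cast : ∀ {n n' m m'} → n ≡ n' → m ≡ m' → n ⟶* m → n' ⟶* m'
  ⟶*-cast refl refl steps = steps

  control-swap : ∀ {σ q X Y} → Yields (val σ * (π (p q) * π X)) (val σ * (π (p q) * π Y)) (π Y , π X)
  control-swap {σ} {q} {X} {Y} = swap (val σ) (π (p q)) (π X) (π Y)
    where swap : ∀ v w x y → v * (w * y) * x ≡ v * (w * x) * y
          swap = solve-∀

  leftBlocks rightBlocks copyBlocks : List (List Fraction)
  leftBlocks  = map halveL bits ∷ map doubleR bits ∷ map writeR bits ∷ map readL bits ∷ map finishL bits ∷ []
  rightBlocks = map halveR bits ∷ map doubleL bits ∷ map writeL bits ∷ map readR bits ∷ map finishR bits ∷ []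
  copyBlocks  = map restoreL bits ∷ map restoreR bits ∷ map finishCopy bits ∷ []

  leftBlocks-inapplicable : ∀ {n} → (∀ y → π (mL y) ∤ n) → All (All (Inapplicable n)) leftBlocks
  leftBlocks-inapplicable mL∤n =
    keyed-absent halveL-keyed mL∤n ∷ keyed-absent doubleR-keyed mL∤n ∷ keyed-absent writeR-keyed mL∤n
    ∷ keyed-absent readL-keyed mL∤n ∷ keyed-absent finishL-keyed mL∤n ∷ []

  rightBlocks-inapplicable : ∀ {n} → (∀ y → π (mR y) ∤ n) → All (All (Inapplicable n)) rightBlocks
  rightBlocks-inapplicable mR∤n =
    keyed-absent halveR-keyed mR∤n ∷ keyed-absent doubleL-keyed mR∤n ∷ keyed-absent writeL-keyed mR∤n
    ∷ keyed-absent readR-keyed mR∤n ∷ keyed-absent finishR-keyed mR∤n ∷ []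

  copyBlocks-inapplicable : ∀ {n} → (∀ y → π (c y) ∤ n) → All (All (Inapplicable n)) copyBlocks
  copyBlocks-inapplicable c∤n =
    keyed-absent restoreL-keyed c∤n ∷ keyed-absent restoreR-keyed c∤n ∷ keyed-absent finishCopy-keyed c∤n ∷ []

  -- Rule (4): copying l', r' back to l, r

  module _ {q : Fin K} where

    private
      other-c : ∀ x σ → π (c (flipB x)) ∤ phase q (c x) σ
      other-c x σ = phase-control-absent σ tt (λ eq → key≢flip {c} (λ ()) x (sym eq))

      mL∤ : ∀ x σ y → π (mL y) ∤ phase q (c x) σ
      mL∤ x σ y = phase-control-absent σ tt (λ ())

      mR∤ : ∀ x σ y → π (mR y) ∤ phase q (c x) σ
      mR∤ x σ y = phase-control-absent σ tt (λ ())

    restoreL-skip : ∀ x σ → L′ σ ≡ 0 → All (Inapplicable (phase q (c x) σ)) (map restoreL bits)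
    restoreL-skip x σ L′≡0 = keyed-skip restoreL-keyed x
      (inapplicable-by-absent (π-prime l') (n∣m*n (π (c x))) (phase-absent σ L′≡0 (λ ()) (λ ())) (π∤π*π (λ ()) (λ ()))) (other-c x σ)

    restoreR-skip : ∀ x σ → R′ σ ≡ 0 → All (Inapplicable (phase q (c x) σ)) (map restoreR bits)
    restoreR-skip x σ R′≡0 = keyed-skip restoreR-keyed x
      (inapplicable-by-absent (π-prime r') (n∣m*n (π (c x))) (phase-absent σ R′≡0 (λ ()) (λ ())) (π∤π*π (λ ()) (λ ()))) (other-c x σ)

    restoreL-step : ∀ x ρ → H′ ρ ≡ 0 → phase q (c x) (bump l' 1 ρ) ⟶ phase q (c (flipB x)) (bump l 1 ρ)
    restoreL-step x ρ H′≡0 = step (skip (phase-killBlock σ tt (inj₂ H′≡0))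
      (skip-blocks (leftBlocks-inapplicable (mL∤ x σ)) (skip-blocks (rightBlocks-inapplicable (mR∤ x σ))
      (fire (keyed-fire restoreL-keyed x
        (yields-transfer l' l 1 1 ρ q (c x) (c (flipB x)) (*-identityʳ (π l)) (*-identityʳ (π l'))) (other-c x σ))))))
      where σ = bump l' 1 ρ

    restoreR-step : ∀ x ρ → L′ ρ ≡ 0 → H′ ρ ≡ 0 → phase q (c x) (bump r' 1 ρ) ⟶ phase q (c (flipB x)) (bump r 1 ρ)
    restoreR-step x ρ L′≡0 H′≡0 = step (skip (phase-killBlock σ tt (inj₂ H′≡0))
      (skip-blocks (leftBlocks-inapplicable (mL∤ x σ)) (skip-blocks (rightBlocks-inapplicable (mR∤ x σ)) (skip (restoreL-skip x σ L′≡0)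
      (fire (keyed-fire restoreR-keyed x
        (yields-transfer r' r 1 1 ρ q (c x) (c (flipB x)) (*-identityʳ (π r)) (*-identityʳ (π r'))) (other-c x σ)))))))
      where σ = bump r' 1 ρ

    finishCopy-step : ∀ x σ → L′ σ ≡ 0 → R′ σ ≡ 0 → H′ σ ≡ 0 → phase q (c x) σ ⟶ atState q σ
    finishCopy-step x σ L′≡0 R′≡0 H′≡0 = step (skip (phase-killBlock σ tt (inj₂ H′≡0))
      (skip-blocks (leftBlocks-inapplicable (mL∤ x σ)) (skip-blocks (rightBlocks-inapplicable (mR∤ x σ))
      (skip (restoreL-skip x σ L′≡0) (skip (restoreR-skip x σ R′≡0)
      (fire (keyed-fire finishCopy-keyed x (drop (val σ) (π (p q)) (π (c x))) (other-c x σ))))))))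
      where drop : ∀ v w x → v * w * x ≡ v * (w * x) * 1
            drop = solve-∀

    restoreL-loop : ∀ k x ρ → H′ ρ ≡ 0 →
                    Reach (phase q (c x) (record ρ { L′ = k })) (λ x' → phase q (c x') (record ρ { L = k + L ρ ; L′ = 0 }))
    restoreL-loop zero    x ρ H′≡0 = x , ε
    restoreL-loop (suc k) x ρ H′≡0 with restoreL-loop k (flipB x) (record ρ { L = suc (L ρ) }) H′≡0
    ... | x' , steps = x' , restoreL-step x (record ρ { L′ = k }) H′≡0
                          ◅ ⟶*-cast refl (cong (λ j → phase q (c x') (record ρ { L = j ; L′ = 0 })) (+-suc k (L ρ))) steps

    restoreR-loop : ∀ k x ρ → L′ ρ ≡ 0 → H′ ρ ≡ 0 →
                    Reach (phase q (c x) (record ρ { R′ = k })) (λ x' → phase q (c x') (record ρ { R = k + R ρ ; R′ = 0 }))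
    restoreR-loop zero    x ρ L′≡0 H′≡0 = x , ε
    restoreR-loop (suc k) x ρ L′≡0 H′≡0 with restoreR-loop k (flipB x) (record ρ { R = suc (R ρ) }) L′≡0 H′≡0
    ... | x' , steps = x' , restoreR-step x (record ρ { R′ = k }) L′≡0 H′≡0
                          ◅ ⟶*-cast refl (cong (λ j → phase q (c x') (record ρ { R = j ; R′ = 0 })) (+-suc k (R ρ))) steps

    simulate-copy : ∀ L R e → phase q (c f0) (regs 0 L 0 R e 0) ⟶* atState q (regs L 0 R 0 e 0)
    simulate-copy L R e with restoreL-loop L f0 (regs 0 0 0 R e 0) refl
    ... | x₁ , copyL with restoreR-loop R x₁ (regs (L + 0) 0 0 0 e 0) refl refl
    ... | x₂ , copyR = copyL ◅◅ copyR ◅◅ finishCopy-step x₂ (regs (L + 0) 0 (R + 0) 0 e 0) refl refl refl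
                       ◅ ⟶*-cast refl (cong₂ (λ L R → atState q (regs L 0 R 0 e 0)) (+-identityʳ L) (+-identityʳ R)) ε

  -- Rule (2): moving the head to the left

  module _ {q : Fin K} where

    private
      other-mL : ∀ x σ → π (mL (flipB x)) ∤ phase q (mL x) σ
      other-mL x σ = phase-control-absent σ tt (λ eq → key≢flip {mL} (λ ()) x (sym eq))

    halveL-skip : ∀ x σ → L σ < 2 → All (Inapplicable (phase q (mL x) σ)) (map halveL bits)
    halveL-skip x σ L<2 = keyed-skip halveL-keyed x
      (register-inapplicable l σ (n∣m*n (π (mL x))) L<2 (π∤π*π (λ ()) (λ ())) (π∤π*π (λ ()) (λ ()))) (other-mL x σ)

    doubleR-skip : ∀ x σ → R σ ≡ 0 → All (Inapplicable (phase q (mL x) σ)) (map doubleR bits)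
    doubleR-skip x σ R≡0 = keyed-skip doubleR-keyed x
      (inapplicable-by-absent (π-prime r) (n∣m*n (π (mL x))) (phase-absent σ R≡0 (λ ()) (λ ()))
        (π∤* (π∤π (λ ())) (prime∤^ (π-prime r) 2 (π∤π (λ ()))))) (other-mL x σ)

    writeR-skip : ∀ x σ → H′ σ ≡ 0 → All (Inapplicable (phase q (mL x) σ)) (map writeR bits)
    writeR-skip x σ H′≡0 = keyed-skip writeR-keyed x
      (inapplicable-by-absent (π-prime h') (n∣m*n (π (mL x))) (phase-absent σ H′≡0 (λ ()) (λ ())) (π∤π*π (λ ()) (λ ()))) (other-mL x σ)

    readL-skip : ∀ x σ → L σ ≡ 0 → All (Inapplicable (phase q (mL x) σ)) (map readL bits)
    readL-skip x σ L≡0 = keyed-skip readL-keyed x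
      (inapplicable-by-absent (π-prime l) (n∣m*n (π (mL x))) (phase-absent σ L≡0 (λ ()) (λ ())) (π∤π*π (λ ()) (λ ()))) (other-mL x σ)

    halveL-step : ∀ x ρ → H ρ ≡ 0 ⊎ H′ ρ ≡ 0 → phase q (mL x) (bump l 2 ρ) ⟶ phase q (mL (flipB x)) (bump l' 1 ρ)
    halveL-step x ρ H≡0⊎H′≡0 = step (skip (phase-killBlock (bump l 2 ρ) tt H≡0⊎H′≡0)
      (fire (keyed-fire halveL-keyed x
        (yields-transfer l l' 2 1 ρ q (mL x) (mL (flipB x)) (*-identityʳ (π l')) refl) (other-mL x (bump l 2 ρ)))))

    doubleR-step : ∀ x ρ → L ρ < 2 → H ρ ≡ 0 ⊎ H′ ρ ≡ 0 → phase q (mL x) (bump r 1 ρ) ⟶ phase q (mL (flipB x)) (bump r' 2 ρ)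
    doubleR-step x ρ L<2 H≡0⊎H′≡0 = step (skip (phase-killBlock (bump r 1 ρ) tt H≡0⊎H′≡0) (skip (halveL-skip x (bump r 1 ρ) L<2)
      (fire (keyed-fire doubleR-keyed x
        (yields-transfer r r' 1 2 ρ q (mL x) (mL (flipB x)) refl (*-identityʳ (π r))) (other-mL x (bump r 1 ρ))))))

    writeR-step : ∀ x e L′ R′ → e < 2 → phase q (mL x) (regs e L′ 0 R′ 0 1) ⟶ phase q (mL (flipB x)) (regs e L′ 0 (suc R′) 0 0)
    writeR-step x e L′ R′ e<2 = step (skip (phase-killBlock σ tt (inj₁ refl)) (skip (halveL-skip x σ e<2) (skip (doubleR-skip x σ refl)
      (fire (keyed-fire writeR-keyed x
        (yields-transfer h' r' 1 1 (regs e L′ 0 R′ 0 0) q (mL x) (mL (flipB x)) (*-identityʳ (π r')) (*-identityʳ (π h')))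
                                      (other-mL x σ))))))
      where σ = regs e L′ 0 R′ 0 1

    readL-step : ∀ x L′ R′ → phase q (mL x) (regs 1 L′ 0 R′ 0 0) ⟶ phase q (mL (flipB x)) (regs 0 L′ 0 R′ 1 0)
    readL-step x L′ R′ = step (skip (phase-killBlock σ tt (inj₁ refl)) (skip (halveL-skip x σ (s≤s (s≤s z≤n)))
      (skip (doubleR-skip x σ refl) (skip (writeR-skip x σ refl)
      (fire (keyed-fire readL-keyed x
        (yields-transfer l h 1 1 (regs 0 L′ 0 R′ 0 0) q (mL x) (mL (flipB x)) (*-identityʳ (π h)) (*-identityʳ (π l)))
                                     (other-mL x σ)))))))
      where σ = regs 1 L′ 0 R′ 0 0

    finishL-step : ∀ x L′ R′ e → phase q (mL x) (regs 0 L′ 0 R′ e 0) ⟶ phase q (c f0) (regs 0 L′ 0 R′ e 0)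
    finishL-step x L′ R′ e = step (skip (phase-killBlock σ tt (inj₂ refl)) (skip (halveL-skip x σ (s≤s z≤n))
      (skip (doubleR-skip x σ refl) (skip (writeR-skip x σ refl) (skip (readL-skip x σ refl)
      (fire (keyed-fire finishL-keyed x (control-swap {σ} {q} {mL x} {c f0}) (other-mL x σ))))))))
      where σ = regs 0 L′ 0 R′ e 0

    halveL-loop : ∀ k a x ρ → H ρ ≡ 0 ⊎ H′ ρ ≡ 0 →
                  Reach (phase q (mL x) (record ρ { L = double k + a })) (λ x' → phase q (mL x') (record ρ { L = a ; L′ = k + L′ ρ }))
    halveL-loop zero    a x ρ _         = x , ε
    halveL-loop (suc k) a x ρ H≡0⊎H′≡0 with halveL-loop k a (flipB x) (record ρ { L′ = suc (L′ ρ) }) H≡0⊎H′≡0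
    ... | x' , steps = x' , halveL-step x (record ρ { L = double k + a }) H≡0⊎H′≡0
                          ◅ ⟶*-cast refl (cong (λ j → phase q (mL x') (record ρ { L = a ; L′ = j })) (+-suc k (L′ ρ))) steps

    doubleR-loop : ∀ k x ρ → L ρ < 2 → H ρ ≡ 0 ⊎ H′ ρ ≡ 0 →
                   Reach (phase q (mL x) (record ρ { R = k })) (λ x' → phase q (mL x') (record ρ { R = 0 ; R′ = double k + R′ ρ }))
    doubleR-loop zero    x ρ _   _         = x , ε
    doubleR-loop (suc k) x ρ L<2 H≡0⊎H′≡0 with doubleR-loop k (flipB x) (record ρ { R′ = 2 + R′ ρ }) L<2 H≡0⊎H′≡0
    ... | x' , steps = x' , doubleR-step x (record ρ { R = k }) L<2 H≡0⊎H′≡0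
                          ◅ ⟶*-cast refl (cong (λ j → phase q (mL x') (record ρ { R = 0 ; R′ = j })) (double-+2 k (R′ ρ))) steps

    writeR-bit : ∀ x e L′ R′ (s : Bit) → e < 2 →
                 Reach (phase q (mL x) (regs e L′ 0 R′ 0 (toℕ s))) (λ x' → phase q (mL x') (regs e L′ 0 (toℕ s + R′) 0 0))
    writeR-bit x e L′ R′ f0        _   = x , ε
    writeR-bit x e L′ R′ (fsuc f0) e<2 = flipB x , writeR-step x e L′ R′ e<2 ◅ ε

    readL-bit : ∀ x (e : Bit) L′ R′ → phase q (mL x) (regs (toℕ e) L′ 0 R′ 0 0) ⟶* phase q (c f0) (regs 0 L′ 0 R′ (toℕ e) 0)
    readL-bit x f0        L′ R′ = finishL-step x L′ R′ 0 ◅ ε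
    readL-bit x (fsuc f0) L′ R′ = readL-step x L′ R′ ◅ finishL-step (flipB x) L′ R′ 1 ◅ ε

    simulate-left : ∀ L R (e s : Bit) →
                    phase q (mL f0) (regs (toℕ e + double L) 0 R 0 0 (toℕ s)) ⟶* atState q (regs L 0 (toℕ s + double R) 0 (toℕ e) 0)
    simulate-left L R e s with halveL-loop L (toℕ e) f0 (regs 0 0 R 0 0 (toℕ s)) (inj₁ refl)
    ... | x₁ , halving with doubleR-loop R x₁ (regs (toℕ e) (L + 0) 0 0 0 (toℕ s)) (toℕ<n e) (inj₁ refl)
    ... | x₂ , doubling with writeR-bit x₂ (toℕ e) (L + 0) (double R + 0) s (toℕ<n e)
    ... | x₃ , writing =
      ⟶*-cast (cong (λ j → phase q (mL f0) (regs j 0 R 0 0 (toℕ s))) (+-comm (double L) (toℕ e)))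
              (cong₂ (λ L R → atState q (regs L 0 R 0 (toℕ e) 0)) (+-identityʳ L) (cong (_+_ (toℕ s)) (+-identityʳ (double R))))
        (halving ◅◅ doubling ◅◅ writing ◅◅ readL-bit x₃ e (L + 0) (toℕ s + (double R + 0))
         ◅◅ simulate-copy (L + 0) (toℕ s + (double R + 0)) (toℕ e))

  -- Rule (3): moving the head to the right

  module _ {q : Fin K} where

    private
      other-mR : ∀ x σ → π (mR (flipB x)) ∤ phase q (mR x) σ
      other-mR x σ = phase-control-absent σ tt (λ eq → key≢flip {mR} (λ ()) x (sym eq))

      mL∤ : ∀ x σ y → π (mL y) ∤ phase q (mR x) σ
      mL∤ x σ y = phase-control-absent σ tt (λ ())

    halveR-skip : ∀ x σ → R σ < 2 → All (Inapplicable (phase q (mR x) σ)) (map halveR bits)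
    halveR-skip x σ R<2 = keyed-skip halveR-keyed x
      (register-inapplicable r σ (n∣m*n (π (mR x))) R<2 (π∤π*π (λ ()) (λ ())) (π∤π*π (λ ()) (λ ()))) (other-mR x σ)

    doubleL-skip : ∀ x σ → L σ ≡ 0 → All (Inapplicable (phase q (mR x) σ)) (map doubleL bits)
    doubleL-skip x σ L≡0 = keyed-skip doubleL-keyed x
      (inapplicable-by-absent (π-prime l) (n∣m*n (π (mR x))) (phase-absent σ L≡0 (λ ()) (λ ()))
        (π∤* (π∤π (λ ())) (prime∤^ (π-prime l) 2 (π∤π (λ ()))))) (other-mR x σ)

    writeL-skip : ∀ x σ → H′ σ ≡ 0 → All (Inapplicable (phase q (mR x) σ)) (map writeL bits)
    writeL-skip x σ H′≡0 = keyed-skip writeL-keyed x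
      (inapplicable-by-absent (π-prime h') (n∣m*n (π (mR x))) (phase-absent σ H′≡0 (λ ()) (λ ())) (π∤π*π (λ ()) (λ ()))) (other-mR x σ)

    readR-skip : ∀ x σ → R σ ≡ 0 → All (Inapplicable (phase q (mR x) σ)) (map readR bits)
    readR-skip x σ R≡0 = keyed-skip readR-keyed x
      (inapplicable-by-absent (π-prime r) (n∣m*n (π (mR x))) (phase-absent σ R≡0 (λ ()) (λ ())) (π∤π*π (λ ()) (λ ()))) (other-mR x σ)

    halveR-step : ∀ x ρ → H ρ ≡ 0 ⊎ H′ ρ ≡ 0 → phase q (mR x) (bump r 2 ρ) ⟶ phase q (mR (flipB x)) (bump r' 1 ρ)
    halveR-step x ρ H≡0⊎H′≡0 = step (skip (phase-killBlock σ tt H≡0⊎H′≡0) (skip-blocks (leftBlocks-inapplicable (mL∤ x σ))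
      (fire (keyed-fire halveR-keyed x
        (yields-transfer r r' 2 1 ρ q (mR x) (mR (flipB x)) (*-identityʳ (π r')) refl) (other-mR x σ)))))
      where σ = bump r 2 ρ

    doubleL-step : ∀ x ρ → R ρ < 2 → H ρ ≡ 0 ⊎ H′ ρ ≡ 0 → phase q (mR x) (bump l 1 ρ) ⟶ phase q (mR (flipB x)) (bump l' 2 ρ)
    doubleL-step x ρ R<2 H≡0⊎H′≡0 = step (skip (phase-killBlock σ tt H≡0⊎H′≡0) (skip-blocks (leftBlocks-inapplicable (mL∤ x σ))
      (skip (halveR-skip x σ R<2)
      (fire (keyed-fire doubleL-keyed x
        (yields-transfer l l' 1 2 ρ q (mR x) (mR (flipB x)) refl (*-identityʳ (π l))) (other-mR x σ))))))
      where σ = bump l 1 ρ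

    writeL-step : ∀ x e L′ R′ → e < 2 → phase q (mR x) (regs 0 L′ e R′ 0 1) ⟶ phase q (mR (flipB x)) (regs 0 (suc L′) e R′ 0 0)
    writeL-step x e L′ R′ e<2 = step (skip (phase-killBlock σ tt (inj₁ refl)) (skip-blocks (leftBlocks-inapplicable (mL∤ x σ))
      (skip (halveR-skip x σ e<2) (skip (doubleL-skip x σ refl)
      (fire (keyed-fire writeL-keyed x
        (yields-transfer h' l' 1 1 (regs 0 L′ e R′ 0 0) q (mR x) (mR (flipB x)) (*-identityʳ (π l')) (*-identityʳ (π h')))
                                      (other-mR x σ)))))))
      where σ = regs 0 L′ e R′ 0 1

    readR-step : ∀ x L′ R′ → phase q (mR x) (regs 0 L′ 1 R′ 0 0) ⟶ phase q (mR (flipB x)) (regs 0 L′ 0 R′ 1 0)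
    readR-step x L′ R′ = step (skip (phase-killBlock σ tt (inj₁ refl)) (skip-blocks (leftBlocks-inapplicable (mL∤ x σ))
      (skip (halveR-skip x σ (s≤s (s≤s z≤n))) (skip (doubleL-skip x σ refl) (skip (writeL-skip x σ refl)
      (fire (keyed-fire readR-keyed x
        (yields-transfer r h 1 1 (regs 0 L′ 0 R′ 0 0) q (mR x) (mR (flipB x)) (*-identityʳ (π h)) (*-identityʳ (π r)))
                                     (other-mR x σ))))))))
      where σ = regs 0 L′ 1 R′ 0 0

    finishR-step : ∀ x L′ R′ e → phase q (mR x) (regs 0 L′ 0 R′ e 0) ⟶ phase q (c f0) (regs 0 L′ 0 R′ e 0)
    finishR-step x L′ R′ e = step (skip (phase-killBlock σ tt (inj₂ refl)) (skip-blocks (leftBlocks-inapplicable (mL∤ x σ))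
      (skip (halveR-skip x σ (s≤s z≤n)) (skip (doubleL-skip x σ refl) (skip (writeL-skip x σ refl) (skip (readR-skip x σ refl)
      (fire (keyed-fire finishR-keyed x (control-swap {σ} {q} {mR x} {c f0}) (other-mR x σ)))))))))
      where σ = regs 0 L′ 0 R′ e 0

    halveR-loop : ∀ k a x ρ → H ρ ≡ 0 ⊎ H′ ρ ≡ 0 →
                  Reach (phase q (mR x) (record ρ { R = double k + a })) (λ x' → phase q (mR x') (record ρ { R = a ; R′ = k + R′ ρ }))
    halveR-loop zero    a x ρ _         = x , ε
    halveR-loop (suc k) a x ρ H≡0⊎H′≡0 with halveR-loop k a (flipB x) (record ρ { R′ = suc (R′ ρ) }) H≡0⊎H′≡0
    ... | x' , steps = x' , halveR-step x (record ρ { R = double k + a }) H≡0⊎H′≡0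
                          ◅ ⟶*-cast refl (cong (λ j → phase q (mR x') (record ρ { R = a ; R′ = j })) (+-suc k (R′ ρ))) steps

    doubleL-loop : ∀ k x ρ → R ρ < 2 → H ρ ≡ 0 ⊎ H′ ρ ≡ 0 →
                   Reach (phase q (mR x) (record ρ { L = k })) (λ x' → phase q (mR x') (record ρ { L = 0 ; L′ = double k + L′ ρ }))
    doubleL-loop zero    x ρ _   _         = x , ε
    doubleL-loop (suc k) x ρ R<2 H≡0⊎H′≡0 with doubleL-loop k (flipB x) (record ρ { L′ = 2 + L′ ρ }) R<2 H≡0⊎H′≡0
    ... | x' , steps = x' , doubleL-step x (record ρ { L = k }) R<2 H≡0⊎H′≡0
                          ◅ ⟶*-cast refl (cong (λ j → phase q (mR x') (record ρ { L = 0 ; L′ = j })) (double-+2 k (L′ ρ))) steps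

    writeL-bit : ∀ x e L′ R′ (s : Bit) → e < 2 →
                 Reach (phase q (mR x) (regs 0 L′ e R′ 0 (toℕ s))) (λ x' → phase q (mR x') (regs 0 (toℕ s + L′) e R′ 0 0))
    writeL-bit x e L′ R′ f0        _   = x , ε
    writeL-bit x e L′ R′ (fsuc f0) e<2 = flipB x , writeL-step x e L′ R′ e<2 ◅ ε

    readR-bit : ∀ x (e : Bit) L′ R′ → phase q (mR x) (regs 0 L′ (toℕ e) R′ 0 0) ⟶* phase q (c f0) (regs 0 L′ 0 R′ (toℕ e) 0)
    readR-bit x f0        L′ R′ = finishR-step x L′ R′ 0 ◅ ε
    readR-bit x (fsuc f0) L′ R′ = readR-step x L′ R′ ◅ finishR-step (flipB x) L′ R′ 1 ◅ ε

    simulate-right : ∀ L R (e s : Bit) →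
                     phase q (mR f0) (regs L 0 (toℕ e + double R) 0 0 (toℕ s)) ⟶* atState q (regs (toℕ s + double L) 0 R 0 (toℕ e) 0)
    simulate-right L R e s with halveR-loop R (toℕ e) f0 (regs L 0 0 0 0 (toℕ s)) (inj₁ refl)
    ... | x₁ , halving with doubleL-loop L x₁ (regs 0 0 (toℕ e) (R + 0) 0 (toℕ s)) (toℕ<n e) (inj₁ refl)
    ... | x₂ , doubling with writeL-bit x₂ (toℕ e) (double L + 0) (R + 0) s (toℕ<n e)
    ... | x₃ , writing =
      ⟶*-cast (cong (λ j → phase q (mR f0) (regs L 0 j 0 0 (toℕ s))) (+-comm (double R) (toℕ e)))
              (cong₂ (λ L R → atState q (regs L 0 R 0 (toℕ e) 0)) (cong (_+_ (toℕ s)) (+-identityʳ (double L))) (+-identityʳ R))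
        (halving ◅◅ doubling ◅◅ writing ◅◅ readR-bit x₃ e (toℕ s + (double L + 0)) (R + 0)
         ◅◅ simulate-copy (toℕ s + (double L + 0)) (R + 0) (toℕ e))

  -- Rules (5)–(7): reading the head

  instruction : Fin K → ℕ → Fin K × Bit × Dir → Fraction
  instruction q e (q' , s' , d) = (π (p q') * π h' ^ toℕ s' * π (mD d f0) , π (p q) * e)

  readOne readZero : List Fraction
  readOne  = lookup (blocks M π) (# 14)
  readZero = lookup (blocks M π) (# 16)

  private
    embed : ∀ {g : Fin K → List Fraction} {x} t → x ∈ g t → x ∈ concatMap g (allFin K)
    embed t x∈gt = ∈-concatMap⁺ _ (Any.map (λ { refl → x∈gt }) (∈-allFin t))

    member : ∀ {g : Fin K → List Fraction} {x} → x ∈ concatMap g (allFin K) → Σ[ t ∈ Fin K ] x ∈ g t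
    member x∈ = Any.satisfied (∈-concatMap⁻ _ {xs = allFin K} x∈)

  -- Ascribing the type of 'embed t' unfolds the rule of 'blocks' at t, exposing δ t b to 'with'.
  readOne-contains : ∀ {t v} → δ t (fsuc f0) ≡ just v → instruction t (π h) v ∈ readOne
  readOne-contains {t} {v} eq with (_ → instruction t (π h) v ∈ readOne) ∋ embed t
  ... | emb with δ t (fsuc f0) | eq
  ... | just _ | refl = emb (here refl)

  readOne-member : ∀ {x} → x ∈ readOne → Σ[ t ∈ Fin K ] Σ[ v ∈ Fin K × Bit × Dir ] (δ t (fsuc f0) ≡ just v × x ≡ instruction t (π h) v)
  readOne-member x∈ with member x∈
  ... | t , x∈t with δ t (fsuc f0) in eq
  ... | just v with x∈t
  ... | here x≡ = t , v , eq , x≡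

  readZero-contains : ∀ {t v} → δ t f0 ≡ just v → instruction t 1 v ∈ readZero
  readZero-contains {t} {v} eq with (_ → instruction t 1 v ∈ readZero) ∋ embed t
  ... | emb with δ t f0 | eq
  ... | just _ | refl = emb (here refl)

  readZero-member : ∀ {x} → x ∈ readZero → Σ[ t ∈ Fin K ] Σ[ v ∈ Fin K × Bit × Dir ] (δ t f0 ≡ just v × x ≡ instruction t 1 v)
  readZero-member x∈ with member x∈
  ... | t , x∈t with δ t f0 in eq
  ... | just v with x∈t
  ... | here x≡ = t , v , eq , x≡

  record InstructionBlock (b : Bit) (e : ℕ) (B : List Fraction) : Set where
    field
      contains : ∀ {t v} → δ t b ≡ just v → instruction t e v ∈ B
      members  : ∀ {x} → x ∈ B → Σ[ t ∈ Fin K ] Σ[ v ∈ Fin K × Bit × Dir ] (δ t b ≡ just v × x ≡ instruction t e v)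

  readOne-block : InstructionBlock (fsuc f0) (π h) readOne
  readOne-block = record { contains = readOne-contains ; members = readOne-member }

  readZero-block : InstructionBlock f0 1 readZero
  readZero-block = record { contains = readZero-contains ; members = readZero-member }

  private
    numerator-free : ∀ {s q' s' d} → s ≢ p q' → s ≢ h' → s ≢ mD d f0 → π s ∤ proj₁ (instruction q' 1 (q' , s' , d))
    numerator-free {s' = s'} s≢q' s≢h' s≢m = π∤* (π∤* (π∤π s≢q') (prime∤^ (π-prime _) (toℕ s') (π∤π s≢h'))) (π∤π s≢m)

    p≢mD : ∀ {t} d → p t ≢ mD {K} d f0
    p≢mD dL ()
    p≢mD dR ()

    h≢mD : ∀ d → h ≢ mD {K} d f0
    h≢mD dL ()
    h≢mD dR ()

  -- No self-loops: an instruction from state t never re-creates p_t, so it needs p_t to be present.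
  instruction-inapplicable : ∀ {t b e v n} → δ t b ≡ just v → π (p t) ∤ n → Inapplicable n (instruction t e v)
  instruction-inapplicable {t} {b} {v = q' , s' , d} eq t∤n = inapplicable-by-absent (π-prime _) (m∣m*n _) t∤n
    (numerator-free {s' = s'} (λ t≡q' → no-self-loop t b q' s' d eq (p-injective t≡q')) (λ ()) (p≢mD d))

  instruction-inapplicable-h : ∀ {t} v {n} → π h ∤ n → Inapplicable n (instruction t (π h) v)
  instruction-inapplicable-h {t} (q' , s' , d) h∤n = inapplicable-by-absent (π-prime _) (n∣m*n (π (p t))) h∤n
    (numerator-free {s' = s'} (λ ()) (λ ()) (h≢mD d))

  module _ {b e B} (block : InstructionBlock b e B) where
    open InstructionBlock block

    instructions-inapplicable : ∀ {n} → (∀ t v → δ t b ≡ just v → Inapplicable n (instruction t e v)) → All (Inapplicable n) B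
    instructions-inapplicable inapplicable-at =
      All.tabulate λ x∈B → case members x∈B of λ { (t , v , eq , refl) → inapplicable-at t v eq }

    instructions-fire : ∀ {n m q v} → δ q b ≡ just v → Yields n m (instruction q e v) → (∀ t → t ≢ q → π (p t) ∤ n) →
                        BlockFires n m B
    instructions-fire {n} {m} {q} {v} eq yields others = All.tabulate admissible , Any.map (λ { refl → yields }) (contains eq)
      where
      admissible : ∀ {x} → x ∈ B → Inapplicable n x ⊎ Yields n m x
      admissible x∈B with members x∈B
      ... | t , v' , eq' , refl with t Fin.≟ q
      ... | no t≢q   = inj₁ (instruction-inapplicable eq' (others t t≢q))
      ... | yes refl with trans (sym eq) eq'
      ... | refl     = inj₂ yields

  erase : Fin K → Fraction
  erase q = (1 , π (p q) * π h)

  erase-inapplicable : ∀ {t n} → π (p t) ∤ n ⊎ π h ∤ n → Inapplicable n (erase t)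
  erase-inapplicable {t} (inj₁ t∤n) = inapplicable-by-absent (π-prime _) (m∣m*n _) t∤n (prime∤1 (π-prime _))
  erase-inapplicable {t} (inj₂ h∤n) = inapplicable-by-absent (π-prime _) (n∣m*n (π (p t))) h∤n (prime∤1 (π-prime _))

  erasures-fire : ∀ {n m q} → Yields n m (erase q) → (∀ t → t ≢ q → π (p t) ∤ n) → BlockFires n m (map erase (allFin K))
  erasures-fire {n} {m} {q} yields others =
    All.map⁺ (All.universal admissible (allFin K)) , Any-map⁺ (Any.map (λ { refl → yields }) (∈-allFin q))
    where
    admissible : ∀ t → Inapplicable n (erase t) ⊎ Yields n m (erase t)
    admissible t with t Fin.≟ q
    ... | yes refl = inj₂ yields
    ... | no t≢q   = inj₁ (erase-inapplicable (inj₁ (others t t≢q)))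

  rules1to4 : List (List Fraction)
  rules1to4 = killBlock ∷ leftBlocks ++ rightBlocks ++ copyBlocks

  uncontrolled-inapplicable : ∀ {n} → (∀ {s} → Control s → π s ∤ n) → AtMostOnePresent n states → π h ∤ n ⊎ π h' ∤ n →
                              All (All (Inapplicable n)) rules1to4
  uncontrolled-inapplicable controls∤n states-amo hh =
    killBlock-inapplicable (none-present (All-controls controls∤n)) states-amo hh
    ∷ All.++⁺ (leftBlocks-inapplicable (λ _ → controls∤n tt))
        (All.++⁺ (rightBlocks-inapplicable (λ _ → controls∤n tt)) (copyBlocks-inapplicable (λ _ → controls∤n tt)))

  instructions-missing : ∀ {b e B n q} → InstructionBlock b e B → δ q b ≡ nothing → (∀ t → t ≢ q → π (p t) ∤ n) →
                         All (Inapplicable n) B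
  instructions-missing {b} {e} {n = n} {q} block δ≡nothing others = instructions-inapplicable block not-q
    where
    not-q : ∀ t v → δ t b ≡ just v → Inapplicable n (instruction t e v)
    not-q t _ δ≡just with t Fin.≟ q
    ... | yes refl = case trans (sym δ≡nothing) δ≡just of λ ()
    ... | no t≢q   = instruction-inapplicable δ≡just (others t t≢q)

  module _ {q : Fin K} where

    private
      controls∤ : ∀ σ {s} → Control s → π s ∤ atState q σ
      controls∤ σ {mL _} _ = atState-absent σ refl (λ ())
      controls∤ σ {mR _} _ = atState-absent σ refl (λ ())
      controls∤ σ {c _}  _ = atState-absent σ refl (λ ())

      others∤ : ∀ σ t → t ≢ q → π (p t) ∤ atState q σ
      others∤ σ t t≢q = atState-absent σ refl (λ pt≡pq → t≢q (p-injective pt≡pq))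

      states-amo : ∀ σ → AtMostOnePresent (atState q σ) states
      states-amo σ = only-present states-distinct
        (All.map⁺ (All.universal (λ t pt≢pq → others∤ σ t (λ t≡q → pt≢pq (cong p t≡q))) (allFin K)))

      rules1to4-inapplicable : ∀ L R H → All (All (Inapplicable (atState q (regs L 0 R 0 H 0)))) rules1to4
      rules1to4-inapplicable L R H = uncontrolled-inapplicable (controls∤ σ) (states-amo σ) (inj₂ (atState-absent σ refl (λ ())))
        where σ = regs L 0 R 0 H 0

      h∤ : ∀ L R → π h ∤ atState q (regs L 0 R 0 0 0)
      h∤ L R = atState-absent (regs L 0 R 0 0 0) refl (λ ())

    dispatch : ∀ L R (b : Bit) {q' s' d} → δ q b ≡ just (q' , s' , d) →
               atState q (regs L 0 R 0 (toℕ b) 0) ⟶ phase q' (mD d f0) (regs L 0 R 0 0 (toℕ s'))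
    dispatch L R f0 {q'} {s'} {d} δ≡ = step (skip-blocks (rules1to4-inapplicable L R 0)
      (skip (instructions-inapplicable readOne-block (λ _ v _ → instruction-inapplicable-h v (h∤ L R)))
      (skip (All.map⁺ (All.universal (λ _ → erase-inapplicable (inj₂ (h∤ L R))) (allFin K)))
      (fire (instructions-fire readZero-block δ≡ (shuffle (π l ^ L) (π r ^ R) (π h' ^ toℕ s') (π (p q)) (π (p q')) (π (mD d f0)))
                                               (others∤ (regs L 0 R 0 0 0)))))))
      where shuffle : ∀ a c s t t' m → a * 1 * c * 1 * 1 * s * (t' * m) * (t * 1) ≡ a * 1 * c * 1 * 1 * 1 * t * (t' * s * m)
            shuffle = solve-∀
    dispatch L R (fsuc f0) {q'} {s'} {d} δ≡ = step (skip-blocks (rules1to4-inapplicable L R 1)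
      (fire (instructions-fire readOne-block δ≡ (shuffle (π l ^ L) (π r ^ R) (π h) (π h' ^ toℕ s') (π (p q)) (π (p q')) (π (mD d f0)))
                                              (others∤ (regs L 0 R 0 1 0)))))
      where shuffle : ∀ a c e s t t' m → a * 1 * c * 1 * 1 * s * (t' * m) * (t * e) ≡ a * 1 * c * 1 * (e * 1) * 1 * t * (t' * s * m)
            shuffle = solve-∀

    erase-step : ∀ L R → δ q (fsuc f0) ≡ nothing → atState q (regs L 0 R 0 1 0) ⟶ val (regs L 0 R 0 0 0) * 1
    erase-step L R δ≡nothing = step (skip-blocks (rules1to4-inapplicable L R 1)
      (skip (instructions-missing readOne-block δ≡nothing (others∤ σ))
      (fire (erasures-fire (shuffle (π l ^ L) (π r ^ R) (π h) (π (p q))) (others∤ σ)))))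
      where σ = regs L 0 R 0 1 0
            shuffle : ∀ a c e t → a * 1 * c * 1 * 1 * 1 * 1 * (t * e) ≡ a * 1 * c * 1 * (e * 1) * 1 * t * 1
            shuffle = solve-∀

    stuck-on-zero : ∀ L R → δ q f0 ≡ nothing → Undefined P (atState q (regs L 0 R 0 0 0))
    stuck-on-zero L R δ≡nothing = halted (All.++⁺ (rules1to4-inapplicable L R 0)
      (instructions-inapplicable readOne-block (λ _ v _ → instruction-inapplicable-h v (h∤ L R))
      ∷ All.map⁺ (All.universal (λ _ → erase-inapplicable (inj₂ (h∤ L R))) (allFin K))
      ∷ instructions-missing readZero-block δ≡nothing (others∤ (regs L 0 R 0 0 0)) ∷ []))

  erased-halted : ∀ L R → Undefined P (val (regs L 0 R 0 0 0) * 1)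
  erased-halted L R = halted (All.++⁺
    (uncontrolled-inapplicable controls∤ (none-present (All.map⁺ (All.universal (λ t → absent refl) (allFin K)))) (inj₁ (absent refl)))
    (instructions-inapplicable readOne-block (λ _ v _ → instruction-inapplicable-h v (absent refl))
    ∷ All.map⁺ (All.universal (λ _ → erase-inapplicable (inj₂ (absent refl))) (allFin K))
    ∷ instructions-inapplicable readZero-block (λ _ _ δ≡ → instruction-inapplicable δ≡ (absent refl)) ∷ []))
    where
    σ = regs L 0 R 0 0 0
    absent : ∀ {s} → exponent σ s ≡ 0 → π s ∤ val σ * 1
    absent e≡0 = π∤* (val-absent σ e≡0) (prime∤1 (π-prime _))
    controls∤ : ∀ {s} → Control s → π s ∤ val σ * 1
    controls∤ {mL _} _ = absent refl
    controls∤ {mR _} _ = absent refl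
    controls∤ {c _}  _ = absent refl

  -- Simulating the machine

  enc-atState : ∀ cf → enc π cf ≡ atState (state cf) (regs (Lval cf) 0 (Rval cf) 0 (Hval cf) 0)
  enc-atState cf = reorder (π l ^ Lval cf) (π (p (state cf))) (π h ^ Hval cf) (π r ^ Rval cf)
    where reorder : ∀ a t e c → a * t * e * c ≡ a * 1 * c * 1 * e * 1 * t
          reorder = solve-∀

  simulate-step : ∀ {c₁ c₂} → TMStep M c₁ c₂ → enc π c₁ ⟶* enc π c₂
  simulate-step {c₁} {c₂} (stepL {f = f} δ≡ written shift) =
    ⟶*-cast (sym (enc-atState c₁)) (sym (enc-atState c₂))
      (dispatch (Lval c₁) (Rval c₁) (tape c₁ (+ 0)) δ≡
       ◅ ⟶*-cast (cong (λ L → phase (state c₂) (mL f0) (regs L 0 (Rval c₁) 0 0 (toℕ f))) (sym (Lval-stepL {c = c₁} {c₂} shift)))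
                 (cong (λ R → atState (state c₂) (regs (Lval c₂) 0 R 0 (Hval c₂) 0)) (sym (Rval-stepL {c = c₁} {c₂} written shift)))
                 (simulate-left (Lval c₂) (Rval c₁) (tape c₂ (+ 0)) f))
  simulate-step {c₁} {c₂} (stepR {f = f} δ≡ written shift) =
    ⟶*-cast (sym (enc-atState c₁)) (sym (enc-atState c₂))
      (dispatch (Lval c₁) (Rval c₁) (tape c₁ (+ 0)) δ≡
       ◅ ⟶*-cast (cong (λ R → phase (state c₂) (mR f0) (regs (Lval c₁) 0 R 0 0 (toℕ f))) (sym (Rval-stepR {c = c₁} {c₂} shift)))
                 (cong (λ L → atState (state c₂) (regs L 0 (Rval c₂) 0 (Hval c₂) 0)) (sym (Lval-stepR {c = c₁} {c₂} written shift)))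
                 (simulate-right (Lval c₁) (Rval c₂) (tape c₂ (+ 0)) f))

  halting : ∀ q L R (b : Bit) → δ q b ≡ nothing → Σ[ m ∈ ℕ ] (atState q (regs L 0 R 0 (toℕ b) 0) ⟶* m × Undefined P m)
  halting q L R f0        δ≡nothing = _ , ε , stuck-on-zero L R δ≡nothing
  halting q L R (fsuc f0) δ≡nothing = _ , erase-step L R δ≡nothing ◅ ε , erased-halted L R

  simulate-normal-form : ∀ c₁ → ¬ (Σ[ c ∈ Config K ] TMStep M c₁ c) → Σ[ m ∈ ℕ ] (enc π c₁ ⟶* m × Undefined P m)
  simulate-normal-form c₁ normal with δ (state c₁) (tape c₁ (+ 0)) in δ≡
  ... | just (q' , s' , dL) = ⊥-elim (normal (movedLeft c₁ q' s' , stepL δ≡ refl (movedLeft-shift c₁ q' s')))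
  ... | just (q' , s' , dR) = ⊥-elim (normal (movedRight c₁ q' s' , stepR δ≡ refl (movedRight-shift c₁ q' s')))
  ... | nothing with halting (state c₁) (Lval c₁) (Rval c₁) (tape c₁ (+ 0)) δ≡
  ...   | m , run , stuck = m , ⟶*-cast (sym (enc-atState c₁)) refl run , stuck

lemma1 : (M : UTM) → NoSelfLoop M →
         (π : Sym (UTM.k M) → ℕ) → (∀ s → Prime (π s)) → Injective _≡_ _≡_ π →
         (P : List Fraction) → IsPM M π P →
         ((c₁ c₂ : Config (UTM.k M)) → TMStep M c₁ c₂ →
            Star (FStep P) (enc π c₁) (enc π c₂))
         × ((c₁ : Config (UTM.k M)) → ¬ (Σ[ c ∈ Config (UTM.k M) ] TMStep M c₁ c) →
            Σ[ m ∈ ℕ ] (Star (FStep P) (enc π c₁) m × Undefined P m))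
lemma1 M no-self-loop π π-prime π-injective P P-is-PM = (λ _ _ → simulate-step) , simulate-normal-form
  where open Simulation M no-self-loop π π-prime π-injective P P-is-PM
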